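{- Let $T$ be a Baxter tree-like tableau, and call leaves of $T$ the points of $T$ that are leaves of its underlying binary tree. Then the underlying binary tree of $T$ is complete (every vertex has zero or two children) if and only if the leaves of $T$ form a staircase shape, i.e. they are located on the south-west-to-north-east diagonal starting at the bottommost point of the first column of $T$ and occupy every cell of this diagonal.
   Context: Ferrers diagrams are drawn in English notation. A tree-like tableau (TLT) is a nonempty Ferrers diagram each of whose cells is empty or pointed, such that: (1) the top-left cell is pointed (the root); (2) every non-root pointed cell $c$ has a pointed cell above it in its column or to its left in its row, but not both; the nearest such pointed cell is its parent; (3) every row and column contains a pointed cell. The underlying binary tree has the points as vertices, rooted at the root point; a point whose parent lies above it is the left child of its parent, one whose parent lies to its left is the right child. A TLT contains pattern H if there are rows $r_1$ above $r_2$ and columns $c_1<c_2<c_3$ with all six cells $(r_a,c_b)$ in the diagram such that $(r_1,c_2),(r_2,c_1),(r_2,c_3)$ are pointed and $(r_1,c_3),(r_2,c_2)$ empty; pattern V if there are rows $r_1$ above $r_2$ above $r_3$ and columns $c_1<c_2$ with all six cells in the diagram such that $(r_1,c_2),(r_2,c_1),(r_3,c_2)$ are pointed and $(r_2,c_2),(r_3,c_1)$ empty. A Baxter TLT is a TLT containing neither H nor V. -}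

module Defs where

open import Data.Nat using (ℕ; zero; suc; _+_; _≤_; _<_)
open import Data.Bool using (Bool; true; false)
open import Data.Product using (Σ; ∃; ∃-syntax; _×_; _,_)
open import Data.Sum using (_⊎_)
open import Relation.Nullary using (¬_)
open import Relation.Binary.PropositionalEquality using (_≡_)
open import Function.Bundles using (_⇔_)

-- A (nonempty) Ferrers diagram in English notation: rows 0 .. nrows-1
-- (row 0 on top), row i has len i cells in columns 0 .. len i - 1,
-- row lengths weakly decreasing downwards.
record Ferrers : Set where
  field
    nrows       : ℕ
    len         : ℕ → ℕ
    nonempty    : 0 < nrows
    pos         : ∀ i → i < nrows → 0 < len i
    zero-beyond : ∀ i → nrows ≤ i → len i ≡ 0
    antitone    : ∀ i → len (suc i) ≤ len i

  ncols : ℕ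
  ncols = len 0

open Ferrers public

InD : Ferrers → ℕ → ℕ → Set
InD D i j = i < nrows D × j < len D i

PtAbove : (ℕ → ℕ → Bool) → ℕ → ℕ → Set
PtAbove pt i j = ∃[ k ] (k < i × pt k j ≡ true)

PtLeft : (ℕ → ℕ → Bool) → ℕ → ℕ → Set
PtLeft pt i j = ∃[ k ] (k < j × pt i k ≡ true)

record TLT : Set where
  field
    shape  : Ferrers
    pt     : ℕ → ℕ → Bool
    pt-in  : ∀ i j → pt i j ≡ true → InD shape i j
    root   : pt 0 0 ≡ true
    parent : ∀ i j → pt i j ≡ true → ¬ (i ≡ 0 × j ≡ 0) →
             (PtAbove pt i j ⊎ PtLeft pt i j) × ¬ (PtAbove pt i j × PtLeft pt i j)
    rowOcc : ∀ i → i < nrows shape → ∃[ j ] (pt i j ≡ true)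
    colOcc : ∀ j → j < ncols shape → ∃[ i ] (pt i j ≡ true)

open TLT public

Point : TLT → ℕ → ℕ → Set
Point T i j = pt T i j ≡ true

Empty : TLT → ℕ → ℕ → Set
Empty T i j = InD (shape T) i j × pt T i j ≡ false

ParentAbove : TLT → (i j a b : ℕ) → Set
ParentAbove T i j a b =
  b ≡ j × a < i × Point T a j × (∀ k → a < k → k < i → pt T k j ≡ false)

ParentLeft : TLT → (i j a b : ℕ) → Set
ParentLeft T i j a b =
  a ≡ i × b < j × Point T i b × (∀ k → b < k → k < j → pt T i k ≡ false)

LeftChild : TLT → (a b i j : ℕ) → Set
LeftChild T a b i j = Point T i j × ParentAbove T i j a b

RightChild : TLT → (a b i j : ℕ) → Set
RightChild T a b i j = Point T i j × ParentLeft T i j a b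

HasLeftChild : TLT → ℕ → ℕ → Set
HasLeftChild T a b = ∃[ i ] ∃[ j ] LeftChild T a b i j

HasRightChild : TLT → ℕ → ℕ → Set
HasRightChild T a b = ∃[ i ] ∃[ j ] RightChild T a b i j

Leaf : TLT → ℕ → ℕ → Set
Leaf T i j = Point T i j × ¬ HasLeftChild T i j × ¬ HasRightChild T i j

Complete : TLT → Set
Complete T = ∀ i j → Point T i j →
  (¬ HasLeftChild T i j × ¬ HasRightChild T i j) ⊎ (HasLeftChild T i j × HasRightChild T i j)

ContainsH : TLT → Set
ContainsH T = ∃[ r₁ ] ∃[ r₂ ] ∃[ c₁ ] ∃[ c₂ ] ∃[ c₃ ]
  ( r₁ < r₂ × c₁ < c₂ × c₂ < c₃
  × InD D r₁ c₁ × InD D r₁ c₂ × InD D r₁ c₃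
  × InD D r₂ c₁ × InD D r₂ c₂ × InD D r₂ c₃
  × Point T r₁ c₂ × Point T r₂ c₁ × Point T r₂ c₃
  × Empty T r₁ c₃ × Empty T r₂ c₂ )
  where D = shape T

ContainsV : TLT → Set
ContainsV T = ∃[ r₁ ] ∃[ r₂ ] ∃[ r₃ ] ∃[ c₁ ] ∃[ c₂ ]
  ( r₁ < r₂ × r₂ < r₃ × c₁ < c₂
  × InD D r₁ c₁ × InD D r₁ c₂
  × InD D r₂ c₁ × InD D r₂ c₂
  × InD D r₃ c₁ × InD D r₃ c₂
  × Point T r₁ c₂ × Point T r₂ c₁ × Point T r₃ c₂
  × Empty T r₂ c₂ × Empty T r₃ c₁ )
  where D = shape T

Baxter : TLT → Set
Baxter T = ¬ ContainsH T × ¬ ContainsV T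

BottomFirstCol : TLT → ℕ → Set
BottomFirstCol T r = Point T r 0 × (∀ k → r < k → pt T k 0 ≡ false)

-- leaves are exactly the cells of the SW–NE diagonal through (r , 0),
-- i.e. the cells (i , j) with i + j = r (all of them)
Staircase : TLT → Set
Staircase T = ∃[ r ] (BottomFirstCol T r × (∀ i j → Leaf T i j ⇔ (i + j ≡ r)))

{-# OPTIONS --safe #-}
module Submission where

-- A point has no right child iff it ends its row, and no left child iff it
-- ends its column; so the tree is complete iff all row ends and column ends
-- are leaves.  In a staircase tableau every row and every column meets the
-- antidiagonal in a leaf, which is then its end.  Conversely let the tableau be
-- complete and Baxter, so every row and every column contains a leaf.  No leaf
-- lies strictly south-east of another leaf (a, b): the first point of the lower
-- leaf's row lies right of column b (else H or a point below (a, b)), its parent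
-- lies above it and below row a (else V or a point right of (a, b)), and the end
-- of that parent's row is a leaf south-east of (a, b) in a higher row -- an
-- infinite descent.  Hence leaves in lower rows are in strictly earlier columns,
-- the leaves of consecutive rows are in consecutive columns (a skipped column
-- would have no place for its leaf), and the leaves fill the antidiagonal
-- through the leaf at the bottom of the first column.

open import Defs
open import Data.Bool using (Bool; true)
open import Data.Bool.Properties using (¬-not) renaming (_≟_ to _≟ᵇ_)
open import Data.Empty using (⊥; ⊥-elim)
open import Data.Nat
  using (ℕ; zero; suc; pred; _+_; _∸_; _≤_; _<_; _≤′_; ≤′-refl; ≤′-step; z≤n; _<?_; _≤?_)
open import Data.Nat.Induction using (<-wellFounded)
open import Data.Nat.Properties
open import Data.Product using (∃; ∃-syntax; _×_; _,_; proj₁; proj₂)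
open import Data.Sum using (_⊎_; inj₁; inj₂)
open import Function.Base using (_∘_)
open import Function.Bundles using (_⇔_; mk⇔; Equivalence)
open import Induction.InfiniteDescent using (Descent; descent∧wf⇒empty)
open import Induction.WellFounded using (Acc; acc)
open import Level using (0ℓ)
open import Relation.Binary using (tri<; tri≈; tri>)
open import Relation.Binary.PropositionalEquality using (_≡_; refl; sym; trans; subst; cong)
open import Relation.Nullary using (¬_; Dec; yes; no; contradiction)
open import Relation.Nullary.Decidable using (map′; _×-dec_)
open import Relation.Unary using (Pred; Decidable)

open Equivalence using (to; from)

module _ {P : Pred ℕ 0ℓ} (P? : Decidable P) where

  ∃-bounded? : ∀ N → (∀ {k} → P k → k < N) → Dec (∃ P)
  ∃-bounded? N bound =
    map′ (λ (k , _ , pk) → k , pk) (λ (k , pk) → k , bound pk , pk) (anyUpTo? P? N)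

  least : ∀ {n} → P n → ∃[ m ] (P m × ∀ {k} → k < m → ¬ P k)
  least {n} = search (<-wellFounded n)
    where
    search : ∀ {n} → Acc _<_ n → P n → ∃[ m ] (P m × ∀ {k} → k < m → ¬ P k)
    search {n} (acc smaller) pn with anyUpTo? P? n
    ... | yes (m , m<n , pm) = search (smaller m<n) pm
    ... | no none            = n , pn , λ k<n pk → none (_ , k<n , pk)

  greatest : ∀ N → (∀ {k} → P k → k < N) → ∀ {n} → P n →
             ∃[ m ] (P m × ∀ {k} → m < k → ¬ P k)
  greatest zero    bound pn = ⊥-elim (n≮0 (bound pn))
  greatest (suc N) bound pn with P? N
  ... | yes pN = N , pN , λ N<k pk → <⇒≱ N<k (≤-pred (bound pk))
  ... | no ¬pN = greatest N (λ pk → ≤∧≢⇒< (≤-pred (bound pk)) λ { refl → ¬pN pk }) pn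

pred[n]<n : ∀ {n} → 0 < n → pred n < n
pred[n]<n {suc n} _ = n<1+n n

module _ (D : Ferrers) where

  len-antitone : ∀ {i j} → i ≤ j → len D j ≤ len D i
  len-antitone = go ∘ ≤⇒≤′
    where
    go : ∀ {i j} → i ≤′ j → len D j ≤ len D i
    go ≤′-refl       = ≤-refl
    go (≤′-step i≤j) = ≤-trans (antitone D _) (go i≤j)

  InD-upLeft : ∀ {i j i′ j′} → i′ ≤ i → j′ ≤ j → InD D i j → InD D i′ j′
  InD-upLeft i′≤i j′≤j (i<R , j<len) =
    ≤-<-trans i′≤i i<R , ≤-<-trans j′≤j (<-≤-trans j<len (len-antitone i′≤i))

  lastRow lastColumn : ℕ
  lastRow    = pred (nrows D)
  lastColumn = pred (ncols D)

  lastRow<nrows : lastRow < nrows D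
  lastRow<nrows = pred[n]<n (nonempty D)

  lastColumn<ncols : lastColumn < ncols D
  lastColumn<ncols = pred[n]<n (pos D 0 (nonempty D))

PtBelow : (ℕ → ℕ → Bool) → ℕ → ℕ → Set
PtBelow pt i j = ∃[ k ] (i < k × pt k j ≡ true)

PtRight : (ℕ → ℕ → Bool) → ℕ → ℕ → Set
PtRight pt i j = ∃[ k ] (j < k × pt i k ≡ true)

RowEnd : TLT → ℕ → ℕ → Set
RowEnd T i j = Point T i j × ¬ PtRight (pt T) i j

ColumnEnd : TLT → ℕ → ℕ → Set
ColumnEnd T i j = Point T i j × ¬ PtBelow (pt T) i j

module _ (T : TLT) where

  private
    D : Ferrers
    D = shape T

  pt? : ∀ i j → Dec (Point T i j)
  pt? i j = pt T i j ≟ᵇ true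

  row<nrows : ∀ {i j} → Point T i j → i < nrows D
  row<nrows {i} {j} = proj₁ ∘ pt-in T i j

  column<len : ∀ {i j} → Point T i j → j < len D i
  column<len {i} {j} = proj₂ ∘ pt-in T i j

  column<ncols : ∀ {i j} → Point T i j → j < ncols D
  column<ncols p = <-≤-trans (column<len p) (len-antitone D z≤n)

  row≤lastRow : ∀ {i j} → Point T i j → i ≤ lastRow D
  row≤lastRow = <⇒≤pred ∘ row<nrows

  column≤lastColumn : ∀ {i j} → Point T i j → j ≤ lastColumn D
  column≤lastColumn = <⇒≤pred ∘ column<ncols

  ¬ptBelow-lastRow : ∀ {j} → ¬ PtBelow (pt T) (lastRow D) j
  ¬ptBelow-lastRow (k , last<k , p) = <⇒≱ last<k (row≤lastRow p)

  ¬ptRight-lastColumn : ∀ {i} → ¬ PtRight (pt T) i (lastColumn D)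
  ¬ptRight-lastColumn (k , last<k , p) = <⇒≱ last<k (column≤lastColumn p)

  ptBelow? : ∀ i j → Dec (PtBelow (pt T) i j)
  ptBelow? i j = ∃-bounded? (λ k → (i <? k) ×-dec pt? k j) (nrows D) (row<nrows ∘ proj₂)

  ptRight? : ∀ i j → Dec (PtRight (pt T) i j)
  ptRight? i j = ∃-bounded? (λ k → (j <? k) ×-dec pt? i k) (len D i) (column<len ∘ proj₂)

  nonroot : ∀ {i j} → 0 < i → ¬ (i ≡ 0 × j ≡ 0)
  nonroot 0<i (refl , _) = n≮0 0<i

  no-point-above-and-left : ∀ {i j} → Point T i j → PtAbove (pt T) i j → PtLeft (pt T) i j → ⊥
  no-point-above-and-left {i} {j} p above@(_ , k<i , _) left =
    proj₂ (parent T i j p (nonroot (≤-<-trans z≤n k<i))) (above , left)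

  hasLeftChild⇔ptBelow : ∀ {i j} → Point T i j → HasLeftChild T i j ⇔ PtBelow (pt T) i j
  hasLeftChild⇔ptBelow {i} {j} p = mk⇔
    (λ { (k , _ , pk , refl , i<k , _) → k , i<k , pk })
    (λ below → let (k , (i<k , pk) , nearest) = least (λ k → (i <? k) ×-dec pt? k j) (proj₂ below)
               in k , j , pk , refl , i<k , p , λ l i<l l<k → ¬-not λ pl → nearest l<k (i<l , pl))

  hasRightChild⇔ptRight : ∀ {i j} → Point T i j → HasRightChild T i j ⇔ PtRight (pt T) i j
  hasRightChild⇔ptRight {i} {j} p = mk⇔
    (λ { (_ , k , pk , refl , j<k , _) → k , j<k , pk })
    (λ right → let (k , (j<k , pk) , nearest) = least (λ k → (j <? k) ×-dec pt? i k) (proj₂ right)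
               in i , k , pk , refl , j<k , p , λ l j<l l<k → ¬-not λ pl → nearest l<k (j<l , pl))

  leaf⇔rowEnd×columnEnd : ∀ {i j} → Leaf T i j ⇔ (RowEnd T i j × ColumnEnd T i j)
  leaf⇔rowEnd×columnEnd = mk⇔
    (λ (p , noLeft , noRight) →
       (p , noRight ∘ from (hasRightChild⇔ptRight p)) , (p , noLeft ∘ from (hasLeftChild⇔ptBelow p)))
    (λ ((p , noRight) , (_ , noBelow)) →
       p , noBelow ∘ to (hasLeftChild⇔ptBelow p) , noRight ∘ to (hasRightChild⇔ptRight p))

  leaf⇒rowEnd : ∀ {i j} → Leaf T i j → RowEnd T i j
  leaf⇒rowEnd = proj₁ ∘ to leaf⇔rowEnd×columnEnd

  leaf⇒columnEnd : ∀ {i j} → Leaf T i j → ColumnEnd T i j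
  leaf⇒columnEnd = proj₂ ∘ to leaf⇔rowEnd×columnEnd

  rowEnd-∃ : ∀ {i} → i < nrows D → ∃ (RowEnd T i)
  rowEnd-∃ {i} i<R =
    let (j , p , last) = greatest (pt? i) (len D i) column<len (proj₂ (rowOcc T i i<R))
    in j , p , λ (k , j<k , pk) → last j<k pk

  columnEnd-∃ : ∀ {j} → j < ncols D → ∃[ i ] ColumnEnd T i j
  columnEnd-∃ {j} j<C =
    let (i , p , last) = greatest (λ k → pt? k j) (nrows D) row<nrows (proj₂ (colOcc T j j<C))
    in i , p , λ (k , i<k , pk) → last i<k pk

  rowEnd-unique : ∀ {i j j′} → RowEnd T i j → RowEnd T i j′ → j ≡ j′
  rowEnd-unique {j = j} {j′} (p , noRight) (p′ , noRight′) with <-cmp j j′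
  ... | tri< j<j′ _ _ = contradiction (j′ , j<j′ , p′) noRight
  ... | tri≈ _ j≡j′ _ = j≡j′
  ... | tri> _ _ j′<j = contradiction (j , j′<j , p) noRight′

  columnEnd-unique : ∀ {i i′ j} → ColumnEnd T i j → ColumnEnd T i′ j → i ≡ i′
  columnEnd-unique {i} {i′} (p , noBelow) (p′ , noBelow′) with <-cmp i i′
  ... | tri< i<i′ _ _ = contradiction (i′ , i<i′ , p′) noBelow
  ... | tri≈ _ i≡i′ _ = i≡i′
  ... | tri> _ _ i′<i = contradiction (i , i′<i , p) noBelow′

  leaf-unique-in-row : ∀ {i j j′} → Leaf T i j → Leaf T i j′ → j ≡ j′
  leaf-unique-in-row l l′ = rowEnd-unique (leaf⇒rowEnd l) (leaf⇒rowEnd l′)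

  RowEndsAreLeaves ColumnEndsAreLeaves : Set
  RowEndsAreLeaves    = ∀ {i j} → RowEnd T i j → Leaf T i j
  ColumnEndsAreLeaves = ∀ {i j} → ColumnEnd T i j → Leaf T i j

  complete⇔endsAreLeaves : Complete T ⇔ (RowEndsAreLeaves × ColumnEndsAreLeaves)
  complete⇔endsAreLeaves = mk⇔ ends leafless
    where
    ends : Complete T → RowEndsAreLeaves × ColumnEndsAreLeaves
    ends complete = rowEnd⇒leaf , columnEnd⇒leaf
      where
      rowEnd⇒leaf : RowEndsAreLeaves
      rowEnd⇒leaf {i} {j} (p , noRight) with complete i j p
      ... | inj₁ (noLeft , noRight′) = p , noLeft , noRight′
      ... | inj₂ (_ , right)         = contradiction (to (hasRightChild⇔ptRight p) right) noRight
      columnEnd⇒leaf : ColumnEndsAreLeaves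
      columnEnd⇒leaf {i} {j} (p , noBelow) with complete i j p
      ... | inj₁ (noLeft , noRight) = p , noLeft , noRight
      ... | inj₂ (left , _)         = contradiction (to (hasLeftChild⇔ptBelow p) left) noBelow
    leafless : RowEndsAreLeaves × ColumnEndsAreLeaves → Complete T
    leafless (rowEnd⇒leaf , columnEnd⇒leaf) i j p with ptBelow? i j | ptRight? i j
    ... | yes below | yes right =
      inj₂ (from (hasLeftChild⇔ptBelow p) below , from (hasRightChild⇔ptRight p) right)
    ... | no noBelow | no noRight =
      inj₁ (noBelow ∘ to (hasLeftChild⇔ptBelow p) , noRight ∘ to (hasRightChild⇔ptRight p))
    ... | yes below | no noRight =
      contradiction below (proj₂ (leaf⇒columnEnd (rowEnd⇒leaf (p , noRight))))
    ... | no noBelow | yes right =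
      contradiction right (proj₂ (leaf⇒rowEnd (columnEnd⇒leaf (p , noBelow))))

  containsH : ∀ {r₁ r₂ c₁ c₂ c₃} → Point T r₁ c₂ → Point T r₂ c₁ → Point T r₂ c₃ →
              r₁ < r₂ → c₁ < c₂ → c₂ < c₃ → ContainsH T
  containsH {r₁} {r₂} {c₁} {c₂} {c₃} p₁₂ p₂₁ p₂₃ r₁<r₂ c₁<c₂ c₂<c₃ =
    r₁ , r₂ , c₁ , c₂ , c₃ , r₁<r₂ , c₁<c₂ , c₂<c₃ ,
    cell r₁≤r₂ c₁≤c₃ , cell r₁≤r₂ c₂≤c₃ , cell r₁≤r₂ ≤-refl ,
    cell ≤-refl c₁≤c₃ , cell ≤-refl c₂≤c₃ , cell ≤-refl ≤-refl ,
    p₁₂ , p₂₁ , p₂₃ ,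
    (cell r₁≤r₂ ≤-refl , ¬-not λ p₁₃ →
       no-point-above-and-left p₂₃ (r₁ , r₁<r₂ , p₁₃) (c₁ , <-trans c₁<c₂ c₂<c₃ , p₂₁)) ,
    (cell ≤-refl c₂≤c₃ , ¬-not λ p₂₂ →
       no-point-above-and-left p₂₂ (r₁ , r₁<r₂ , p₁₂) (c₁ , c₁<c₂ , p₂₁))
    where
    r₁≤r₂ = <⇒≤ r₁<r₂
    c₂≤c₃ = <⇒≤ c₂<c₃
    c₁≤c₃ = <⇒≤ (<-trans c₁<c₂ c₂<c₃)
    cell : ∀ {r c} → r ≤ r₂ → c ≤ c₃ → InD D r c
    cell r≤ c≤ = InD-upLeft D r≤ c≤ (pt-in T r₂ c₃ p₂₃)

  containsV : ∀ {r₁ r₂ r₃ c₁ c₂} → Point T r₁ c₂ → Point T r₂ c₁ → Point T r₃ c₂ →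
              r₁ < r₂ → r₂ < r₃ → c₁ < c₂ → ContainsV T
  containsV {r₁} {r₂} {r₃} {c₁} {c₂} p₁₂ p₂₁ p₃₂ r₁<r₂ r₂<r₃ c₁<c₂ =
    r₁ , r₂ , r₃ , c₁ , c₂ , r₁<r₂ , r₂<r₃ , c₁<c₂ ,
    cell r₁≤r₃ c₁≤c₂ , cell r₁≤r₃ ≤-refl ,
    cell r₂≤r₃ c₁≤c₂ , cell r₂≤r₃ ≤-refl ,
    cell ≤-refl c₁≤c₂ , cell ≤-refl ≤-refl ,
    p₁₂ , p₂₁ , p₃₂ ,
    (cell r₂≤r₃ ≤-refl , ¬-not λ p₂₂ →
       no-point-above-and-left p₂₂ (r₁ , r₁<r₂ , p₁₂) (c₁ , c₁<c₂ , p₂₁)) ,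
    (cell ≤-refl c₁≤c₂ , ¬-not λ p₃₁ →
       no-point-above-and-left p₃₂ (r₁ , <-trans r₁<r₂ r₂<r₃ , p₁₂) (c₁ , c₁<c₂ , p₃₁))
    where
    r₂≤r₃ = <⇒≤ r₂<r₃
    r₁≤r₃ = <⇒≤ (<-trans r₁<r₂ r₂<r₃)
    c₁≤c₂ = <⇒≤ c₁<c₂
    cell : ∀ {r c} → r ≤ r₃ → c ≤ c₂ → InD D r c
    cell r≤ c≤ = InD-upLeft D r≤ c≤ (pt-in T r₃ c₂ p₃₂)

module CompleteBaxter (T : TLT) (baxter : Baxter T) (complete : Complete T) where

  private
    D : Ferrers
    D = shape T

  rowEnd⇒leaf : RowEndsAreLeaves T
  rowEnd⇒leaf = proj₁ (to (complete⇔endsAreLeaves T) complete)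

  columnEnd⇒leaf : ColumnEndsAreLeaves T
  columnEnd⇒leaf = proj₂ (to (complete⇔endsAreLeaves T) complete)

  leafInRow : ∀ {i} → i < nrows D → ∃ (Leaf T i)
  leafInRow i<R = let (j , end) = rowEnd-∃ T i<R in j , rowEnd⇒leaf end

  leafInColumn : ∀ {j} → j < ncols D → ∃[ i ] Leaf T i j
  leafInColumn j<C = let (i , end) = columnEnd-∃ T j<C in i , columnEnd⇒leaf end

  LeafSouthEastOf : ℕ → ℕ → Pred ℕ 0ℓ
  LeafSouthEastOf a b a′ = ∃[ b′ ] (Leaf T a′ b′ × a < a′ × b < b′)

  leafSouthEast-descent : ∀ {a b} → Leaf T a b → Descent _<_ (LeafSouthEastOf a b)
  leafSouthEast-descent {a} {b} leaf {a′} (b′ , leaf′ , a<a′ , b<b′) =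
    let (f , p′f , first) = least (pt? T a′) (proj₁ leaf′)
        b<f = first-beyond-b f p′f
    in case-parent f p′f first b<f
                   (proj₁ (parent T a′ f p′f (nonroot T (≤-<-trans z≤n a<a′))))
    where
    first-beyond-b : ∀ f → Point T a′ f → b < f
    first-beyond-b f p′f with <-cmp f b
    ... | tri< f<b _ _ =
      ⊥-elim (proj₁ baxter (containsH T (proj₁ leaf) p′f (proj₁ leaf′) a<a′ f<b b<b′))
    ... | tri≈ _ refl _ = ⊥-elim (proj₂ (leaf⇒columnEnd T leaf) (a′ , a<a′ , p′f))
    ... | tri> _ _ b<f = b<f

    above-below-a : ∀ {f x} → Point T a′ f → b < f → Point T x f → x < a′ → a < x
    above-below-a {f} {x} p′f b<f pxf x<a′ with <-cmp x a
    ... | tri< x<a _ _ =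
      ⊥-elim (proj₂ baxter (containsV T pxf (proj₁ leaf) p′f x<a a<a′ b<f))
    ... | tri≈ _ refl _ = ⊥-elim (proj₂ (leaf⇒rowEnd T leaf) (f , b<f , pxf))
    ... | tri> _ _ a<x = a<x

    case-parent : ∀ f → Point T a′ f → (∀ {k} → k < f → ¬ Point T a′ k) → b < f →
                  PtAbove (pt T) a′ f ⊎ PtLeft (pt T) a′ f →
                  ∃[ x ] (x < a′ × LeafSouthEastOf a b x)
    case-parent f p′f first b<f (inj₂ (k , k<f , p′k)) = ⊥-elim (first k<f p′k)
    case-parent f p′f first b<f (inj₁ (x , x<a′ , pxf)) =
      let (m , end) = rowEnd-∃ T (row<nrows T pxf)
          f≤m = ≮⇒≥ λ m<f → proj₂ end (f , m<f , pxf)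
      in x , x<a′ , m , rowEnd⇒leaf end , above-below-a p′f b<f pxf x<a′ , <-≤-trans b<f f≤m

  no-leaf-southEast : ∀ {a b a′ b′} → Leaf T a b → Leaf T a′ b′ → a < a′ → b < b′ → ⊥
  no-leaf-southEast {a′ = a′} {b′} leaf leaf′ a<a′ b<b′ =
    descent∧wf⇒empty (leafSouthEast-descent leaf) <-wellFounded a′ (b′ , leaf′ , a<a′ , b<b′)

  leaf-order : ∀ {a b a′ b′} → Leaf T a b → Leaf T a′ b′ → a < a′ → b′ < b
  leaf-order {b = b} {a′} {b′} leaf leaf′ a<a′ with <-cmp b′ b
  ... | tri< b′<b _ _ = b′<b
  ... | tri≈ _ refl _ = ⊥-elim (proj₂ (leaf⇒columnEnd T leaf) (a′ , a<a′ , proj₁ leaf′))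
  ... | tri> _ _ b<b′ = ⊥-elim (no-leaf-southEast leaf leaf′ a<a′ b<b′)

  leaf-order-≤ : ∀ {a b a′ b′} → Leaf T a b → Leaf T a′ b′ → a ≤ a′ → b′ ≤ b
  leaf-order-≤ leaf leaf′ a≤a′ with m≤n⇒m<n∨m≡n a≤a′
  ... | inj₁ a<a′ = <⇒≤ (leaf-order leaf leaf′ a<a′)
  ... | inj₂ refl = ≤-reflexive (leaf-unique-in-row T leaf′ leaf)

  leaf-next-row : ∀ {i j j′} → Leaf T i j → Leaf T (suc i) j′ → j ≡ suc j′
  leaf-next-row {i} {j′ = j′} leaf leaf′ with m≤n⇒m<n∨m≡n (leaf-order leaf leaf′ (n<1+n i))
  ... | inj₂ 1+j′≡j = sym 1+j′≡j
  ... | inj₁ 1+j′<j with leafInColumn (<-trans 1+j′<j (column<ncols T (proj₁ leaf)))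
  ... | β , leafβ with β ≤? i
  ... | yes β≤i = contradiction (leaf-order-≤ leafβ leaf β≤i) (<⇒≱ 1+j′<j)
  ... | no β≰i  = contradiction (leaf-order-≤ leaf′ leafβ (≰⇒> β≰i)) (1+n≰n {j′})

  bottomLeaf : Leaf T (lastRow D) 0
  bottomLeaf with leafInRow (lastRow<nrows D) | leafInColumn (pos D 0 (nonempty D))
  ... | m , leafₘ | β , leafβ
    with n≤0⇒n≡0 (leaf-order-≤ leafβ leafₘ (row≤lastRow T (proj₁ leafβ)))
  ... | refl = leafₘ

  antidiagonal⇒leaf : ∀ i j → i + j ≡ lastRow D → Leaf T i j
  antidiagonal⇒leaf i zero    i+0≡r =
    subst (λ k → Leaf T k 0) (trans (sym i+0≡r) (+-identityʳ i)) bottomLeaf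
  antidiagonal⇒leaf i (suc j) i+1+j≡r =
    let i≤r       = ≤-trans (m≤m+n i (suc j)) (≤-reflexive i+1+j≡r)
        (k , leafₖ) = leafInRow (≤-<-trans i≤r (lastRow<nrows D))
        below     = antidiagonal⇒leaf (suc i) j (trans (sym (+-suc i j)) i+1+j≡r)
    in subst (Leaf T i) (leaf-next-row leafₖ below) leafₖ

  leaf⇒antidiagonal : ∀ {i j} → Leaf T i j → i + j ≡ lastRow D
  leaf⇒antidiagonal {i} {j} leaf =
    let i≤r = row≤lastRow T (proj₁ leaf)
        on-diagonal = antidiagonal⇒leaf i (lastRow D ∸ i) (m+[n∸m]≡n i≤r)
    in trans (cong (i +_) (leaf-unique-in-row T leaf on-diagonal)) (m+[n∸m]≡n i≤r)

  staircase : Staircase T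
  staircase =
    lastRow D ,
    (proj₁ bottomLeaf , λ k r<k → ¬-not λ pk → ¬ptBelow-lastRow T (k , r<k , pk)) ,
    λ i j → mk⇔ leaf⇒antidiagonal (antidiagonal⇒leaf i j)

staircase⇒complete : (T : TLT) → Staircase T → Complete T
staircase⇒complete T (r , _ , leaf⇔diagonal) =
  from (complete⇔endsAreLeaves T) (rowEnd⇒leaf , columnEnd⇒leaf)
  where
  D : Ferrers
  D = shape T

  onDiagonal : ∀ {i j} → Leaf T i j → i + j ≡ r
  onDiagonal {i} {j} = to (leaf⇔diagonal i j)

  lastRow≤r : lastRow D ≤ r
  lastRow≤r =
    let (m , p , noRight) = rowEnd-∃ T (lastRow<nrows D)
        leaf = from (leaf⇔rowEnd×columnEnd T) ((p , noRight) , (p , ¬ptBelow-lastRow T))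
    in ≤-trans (m≤m+n _ m) (≤-reflexive (onDiagonal leaf))

  lastColumn≤r : lastColumn D ≤ r
  lastColumn≤r =
    let (β , p , noBelow) = columnEnd-∃ T (lastColumn<ncols D)
        leaf = from (leaf⇔rowEnd×columnEnd T) ((p , ¬ptRight-lastColumn T) , (p , noBelow))
    in ≤-trans (m≤n+m _ β) (≤-reflexive (onDiagonal leaf))

  rowEnd⇒leaf : RowEndsAreLeaves T
  rowEnd⇒leaf {i} end =
    let i≤r  = ≤-trans (row≤lastRow T (proj₁ end)) lastRow≤r
        leaf = from (leaf⇔diagonal i (r ∸ i)) (m+[n∸m]≡n i≤r)
    in subst (Leaf T i) (rowEnd-unique T (leaf⇒rowEnd T leaf) end) leaf

  columnEnd⇒leaf : ColumnEndsAreLeaves T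
  columnEnd⇒leaf {j = j} end =
    let j≤r  = ≤-trans (column≤lastColumn T (proj₁ end)) lastColumn≤r
        leaf = from (leaf⇔diagonal (r ∸ j) j) (m∸n+n≡m j≤r)
    in subst (λ k → Leaf T k j) (columnEnd-unique T (leaf⇒columnEnd T leaf) end) leaf

lemma6p2 : (T : TLT) → Baxter T → (Complete T ⇔ Staircase T)
lemma6p2 T baxter = mk⇔ (CompleteBaxter.staircase T baxter) (staircase⇒complete T)
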